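{- Let $A\subseteq\mathbb{P}$ (the positive integers) and let $F^{\mathrm{asc}}(A;x)=\sum_{n\ge0}c_nx^n$, where $c_n$ is the number of Motzkin paths of length $n$ in which every ascent ends at a height in $A$. For $i\ge1$ let $C_i=x^2$ if $i\notin A$ and $C_i=0$ otherwise. Then \[ F^{\mathrm{asc}}(A;x)=\cfrac{1}{1-x+C_1-\cfrac{x^2-xC_1}{1-x+C_2-\cfrac{x^2-xC_2}{1-x+C_3-\cdots}}}. \]
   Context: A Motzkin path of length $n$ is a sequence of $n$ steps $U$ ($+1$), $F$ ($0$), $D$ ($-1$) starting and ending at height $0$ and never going below $0$. An ascent is a maximal run of consecutive $U$ steps; it ends at the height reached after its last $U$ step. An infinite continued fraction denotes the formal power series limit of its finite truncations. -}

module Defs where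

open import Data.Bool using (Bool; true; false; _∧_; if_then_else_)
open import Data.Nat using (ℕ; zero; suc; _∸_; _≡ᵇ_)
open import Data.Integer using (ℤ; +_; -_; _+_; _-_; _*_)
open import Data.List using (List; []; _∷_; map; upTo; zipWith; concatMap; length)

data Step : Set where
  U F D : Step

allWords : ℕ → List (List Step)
allWords zero = [] ∷ []
allWords (suc n) = concatMap (λ s → map (s ∷_) (allWords n)) (U ∷ F ∷ D ∷ [])

motzkinFrom : ℕ → List Step → Bool
motzkinFrom h [] = h ≡ᵇ 0
motzkinFrom h (U ∷ s) = motzkinFrom (suc h) s
motzkinFrom h (F ∷ s) = motzkinFrom h s
motzkinFrom zero (D ∷ s) = false
motzkinFrom (suc h) (D ∷ s) = motzkinFrom h s

isMotzkin : List Step → Bool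
isMotzkin = motzkinFrom 0

-- ascOK A h p : walking p from height h, every maximal run of U steps
-- ends at a height belonging to A
ascOK : (ℕ → Bool) → ℕ → List Step → Bool
ascOK A h [] = true
ascOK A h (U ∷ []) = A (suc h)
ascOK A h (U ∷ U ∷ s) = ascOK A (suc h) (U ∷ s)
ascOK A h (U ∷ F ∷ s) = A (suc h) ∧ ascOK A (suc h) (F ∷ s)
ascOK A h (U ∷ D ∷ s) = A (suc h) ∧ ascOK A (suc h) (D ∷ s)
ascOK A h (F ∷ s) = ascOK A h s
ascOK A h (D ∷ s) = ascOK A (h ∸ 1) s

count : {X : Set} → (X → Bool) → List X → ℕ
count P [] = 0
count P (x ∷ xs) = if P x then suc (count P xs) else count P xs

ascCount : (ℕ → Bool) → ℕ → ℕ
ascCount A n = count (λ p → isMotzkin p ∧ ascOK A 0 p) (allWords n)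

sumℤ : List ℤ → ℤ
sumℤ [] = + 0
sumℤ (z ∷ zs) = z + sumℤ zs

Series : Set
Series = ℕ → ℤ

𝟙 : Series
𝟙 zero = + 1
𝟙 (suc _) = + 0

𝕩 : Series
𝕩 1 = + 1
𝕩 _ = + 0

𝟘 : Series
𝟘 _ = + 0

_⊕_ : Series → Series → Series
(f ⊕ g) n = f n + g n

_⊖_ : Series → Series → Series
(f ⊖ g) n = f n - g n

_⊗_ : Series → Series → Series
(f ⊗ g) n = sumℤ (map (λ i → f i * g (n ∸ i)) (upTo (suc n)))

infixl 6 _⊕_ _⊖_
infixl 7 _⊗_

-- Multiplicative inverse of a series with constant term 1:
-- g 0 = 1, g n = - Σ_{i=1}^{n} f i * g (n - i).
-- invRev f n = [g n , g (n-1) , … , g 0]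
invRev : Series → ℕ → List ℤ
invRev f zero = + 1 ∷ []
invRev f (suc n) =
  let gs = invRev f n in
  (- sumℤ (zipWith _*_ (map (λ i → f (suc i)) (upTo (suc n))) gs)) ∷ gs

headℤ : List ℤ → ℤ
headℤ [] = + 0
headℤ (z ∷ _) = z

inv : Series → Series
inv f n = headℤ (invRev f n)

Cᵢ : (ℕ → Bool) → ℕ → Series
Cᵢ A i = if A i then 𝟘 else 𝕩 ⊗ 𝕩

-- den A k i : the denominator at level i, truncated after k further levels:
-- den A 0 i     = 1 - x + C_i
-- den A (k+1) i = 1 - x + C_i - (x² - x C_i) / den A k (i+1)
den : (ℕ → Bool) → ℕ → ℕ → Series
den A zero i = 𝟙 ⊖ 𝕩 ⊕ Cᵢ A i
den A (suc k) i = 𝟙 ⊖ 𝕩 ⊕ Cᵢ A i ⊖ (𝕩 ⊗ 𝕩 ⊖ 𝕩 ⊗ Cᵢ A i) ⊗ inv (den A k (suc i))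

cfTrunc : (ℕ → Bool) → ℕ → Series
cfTrunc A k = inv (den A k 1)

module Submission where

-- Write E_j for the series counting paths that start and end at height j, never
-- go below j, and whose ascents end in A (heights measured absolutely).  Splitting
-- such a path at its first step, and an ascent at its first return to height j,
-- gives E_j = 1 + x E_j + x² T_j E_j, where T_j counts the paths that continue an
-- ascent at height j + 1; T_j = E_{j+1} if j + 1 ∈ A and T_j = (1 - x) E_{j+1} - 1
-- otherwise.  In both cases this says E_j · (1 - x + C_{j+1} - (x² - x C_{j+1}) E_{j+1}) = 1,
-- so each E_j is the exact value of the continued fraction started at level j + 1.
-- Since x² - x C has no constant term, the k-th truncation of the denominator agrees
-- with the exact one up to degree k; inverses preserve such agreement, hence the
-- n-th coefficient of every truncation of depth k ≥ n equals that of E_0.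

open import Defs
open import Data.Bool using (Bool; true; false; _∧_; if_then_else_)
open import Data.Bool.Properties using (∧-zeroʳ)
open import Data.Nat using (ℕ; zero; suc; _∸_; _≤_; z≤n; s≤s) renaming (_+_ to _+ℕ_)
open import Data.Nat.Properties using (≤-refl; ≤-trans; n≤1+n; +-suc) renaming (+-identityʳ to +ℕ-identityʳ)
open import Data.Integer using (ℤ; +_; -_; _+_; _-_; _*_)
open import Data.Integer.Properties
  using (+-identityˡ; +-identityʳ; *-identityˡ; *-assoc; *-distribʳ-+; *-distribˡ-+; pos-+)
open import Data.Integer.Tactic.RingSolver using (solve-∀)
open import Data.List using (List; []; _∷_; map; _++_; zipWith; applyUpTo; upTo)
open import Data.List.Properties using (map-upTo; map-applyUpTo)
open import Data.Product using (∃-syntax; _,_)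
open import Function using (_∘_)
open import Relation.Binary.PropositionalEquality
  using (_≡_; refl; sym; trans; cong; cong₂; _≗_; module ≡-Reasoning)

_≈[_]_ : Series → ℕ → Series → Set
f ≈[ n ] g = ∀ i → i ≤ n → f i ≡ g i

≈-weaken : ∀ {f g m n} → m ≤ n → f ≈[ n ] g → f ≈[ m ] g
≈-weaken m≤n f≈g i i≤m = f≈g i (≤-trans i≤m m≤n)

≗⇒≈ : ∀ {f g} n → f ≗ g → f ≈[ n ] g
≗⇒≈ n f≗g i _ = f≗g i

⊗-zero : ∀ f g → (f ⊗ g) 0 ≡ f 0 * g 0
⊗-zero f g = +-identityʳ (f 0 * g 0)

⊗-suc : ∀ f g n → (f ⊗ g) (suc n) ≡ f 0 * g (suc n) + ((f ∘ suc) ⊗ g) n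
⊗-suc f g n = trans (cong sumℤ (map-upTo term (suc (suc n))))
                    (cong (_+_ (term 0)) (cong sumℤ (sym (map-upTo (term ∘ suc) (suc n)))))
  where
  term : ℕ → ℤ
  term i = f i * g (suc n ∸ i)

⊗-shift : ∀ f g n → f 0 ≡ + 0 → (f ⊗ g) (suc n) ≡ ((f ∘ suc) ⊗ g) n
⊗-shift f g n f₀≡0 = begin
  (f ⊗ g) (suc n)                          ≡⟨ ⊗-suc f g n ⟩
  f 0 * g (suc n) + ((f ∘ suc) ⊗ g) n      ≡⟨ cong (λ a → a * g (suc n) + ((f ∘ suc) ⊗ g) n) f₀≡0 ⟩
  + 0 + ((f ∘ suc) ⊗ g) n                  ≡⟨ +-identityˡ _ ⟩
  ((f ∘ suc) ⊗ g) n                        ∎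
  where open ≡-Reasoning

⊗-local : ∀ {f f′ g g′} n → f ≈[ n ] f′ → g ≈[ n ] g′ → (f ⊗ g) n ≡ (f′ ⊗ g′) n
⊗-local {f} {f′} {g} {g′} zero f≈ g≈ =
  trans (⊗-zero f g) (trans (cong₂ _*_ (f≈ 0 z≤n) (g≈ 0 z≤n)) (sym (⊗-zero f′ g′)))
⊗-local {f} {f′} {g} {g′} (suc n) f≈ g≈ = begin
  (f ⊗ g) (suc n)                              ≡⟨ ⊗-suc f g n ⟩
  f 0 * g (suc n) + ((f ∘ suc) ⊗ g) n          ≡⟨ cong₂ _+_ (cong₂ _*_ (f≈ 0 z≤n) (g≈ (suc n) ≤-refl))
                                                     (⊗-local n (λ i i≤n → f≈ (suc i) (s≤s i≤n))
                                                                (≈-weaken (n≤1+n n) g≈)) ⟩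
  f′ 0 * g′ (suc n) + ((f′ ∘ suc) ⊗ g′) n      ≡⟨ sym (⊗-suc f′ g′ n) ⟩
  (f′ ⊗ g′) (suc n)                            ∎
  where open ≡-Reasoning

⊗-congˡ : ∀ {f f′} g n → f ≗ f′ → (f ⊗ g) n ≡ (f′ ⊗ g) n
⊗-congˡ g n f≗f′ = ⊗-local {g = g} {g′ = g} n (≗⇒≈ n f≗f′) (λ _ _ → refl)

⊗-⊕ : ∀ f f′ g n → ((f ⊕ f′) ⊗ g) n ≡ (f ⊗ g) n + (f′ ⊗ g) n
⊗-⊕ f f′ g zero
  rewrite ⊗-zero (f ⊕ f′) g | ⊗-zero f g | ⊗-zero f′ g = *-distribʳ-+ (g 0) (f 0) (f′ 0)
⊗-⊕ f f′ g (suc n)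
  rewrite ⊗-suc (f ⊕ f′) g n | ⊗-suc f g n | ⊗-suc f′ g n | ⊗-⊕ (f ∘ suc) (f′ ∘ suc) g n =
  distrib (f 0) (f′ 0) (g (suc n)) _ _
  where
  distrib : ∀ a b c d e → (a + b) * c + (d + e) ≡ (a * c + d) + (b * c + e)
  distrib = solve-∀

⊗-⊖ : ∀ f f′ g n → ((f ⊖ f′) ⊗ g) n ≡ (f ⊗ g) n - (f′ ⊗ g) n
⊗-⊖ f f′ g zero
  rewrite ⊗-zero (f ⊖ f′) g | ⊗-zero f g | ⊗-zero f′ g = distrib (f 0) (f′ 0) (g 0)
  where
  distrib : ∀ a b c → (a - b) * c ≡ a * c - b * c
  distrib = solve-∀
⊗-⊖ f f′ g (suc n)
  rewrite ⊗-suc (f ⊖ f′) g n | ⊗-suc f g n | ⊗-suc f′ g n | ⊗-⊖ (f ∘ suc) (f′ ∘ suc) g n =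
  distrib (f 0) (f′ 0) (g (suc n)) _ _
  where
  distrib : ∀ a b c d e → (a - b) * c + (d - e) ≡ (a * c + d) - (b * c + e)
  distrib = solve-∀

⊗-scale : ∀ c f g n → ((λ i → c * f i) ⊗ g) n ≡ c * (f ⊗ g) n
⊗-scale c f g zero
  rewrite ⊗-zero (λ i → c * f i) g | ⊗-zero f g = *-assoc c (f 0) (g 0)
⊗-scale c f g (suc n)
  rewrite ⊗-suc (λ i → c * f i) g n | ⊗-suc f g n | ⊗-scale c (f ∘ suc) g n =
  distrib c (f 0) (g (suc n)) _
  where
  distrib : ∀ c a b d → c * a * b + c * d ≡ c * (a * b + d)
  distrib = solve-∀

-- (X + wY) g = X g + w (Y g), the shape in which the walk recursion is linear.
⊗-affine : ∀ X w Y g n → ((λ i → X i + w * Y i) ⊗ g) n ≡ (X ⊗ g) n + w * (Y ⊗ g) n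
⊗-affine X w Y g n = trans (⊗-⊕ X (λ i → w * Y i) g n) (cong (_+_ ((X ⊗ g) n)) (⊗-scale w Y g n))

𝟘⊗ : ∀ g n → (𝟘 ⊗ g) n ≡ + 0
𝟘⊗ g zero = ⊗-zero 𝟘 g
𝟘⊗ g (suc n) = trans (⊗-suc 𝟘 g n) (trans (+-identityˡ _) (𝟘⊗ g n))

𝟙⊗ : ∀ g n → (𝟙 ⊗ g) n ≡ g n
𝟙⊗ g zero = trans (⊗-zero 𝟙 g) (*-identityˡ (g 0))
𝟙⊗ g (suc n) = begin
  (𝟙 ⊗ g) (suc n)                  ≡⟨ ⊗-suc 𝟙 g n ⟩
  + 1 * g (suc n) + (𝟘 ⊗ g) n      ≡⟨ cong₂ _+_ (*-identityˡ (g (suc n))) (𝟘⊗ g n) ⟩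
  g (suc n) + + 0                  ≡⟨ +-identityʳ (g (suc n)) ⟩
  g (suc n)                        ∎
  where open ≡-Reasoning

𝕩-suc : (𝕩 ∘ suc) ≗ 𝟙
𝕩-suc zero = refl
𝕩-suc (suc i) = refl

𝕩⊗ : ∀ g n → (𝕩 ⊗ g) (suc n) ≡ g n
𝕩⊗ g n = trans (⊗-shift 𝕩 g n refl) (trans (⊗-congˡ g n 𝕩-suc) (𝟙⊗ g n))

invRev-sum : ∀ f a n → sumℤ (zipWith _*_ (map a (upTo (suc n))) (invRev f n)) ≡ (a ⊗ inv f) n
invRev-sum f a zero = refl
invRev-sum f a (suc n) = begin
  a 0 * inv f (suc n) + sumℤ (zipWith _*_ (map a (applyUpTo suc (suc n))) (invRev f n))
    ≡⟨ cong (λ as → a 0 * inv f (suc n) + sumℤ (zipWith _*_ as (invRev f n))) shifted ⟩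
  a 0 * inv f (suc n) + sumℤ (zipWith _*_ (map (a ∘ suc) (upTo (suc n))) (invRev f n))
    ≡⟨ cong (_+_ (a 0 * inv f (suc n))) (invRev-sum f (a ∘ suc) n) ⟩
  a 0 * inv f (suc n) + ((a ∘ suc) ⊗ inv f) n
    ≡⟨ sym (⊗-suc a (inv f) n) ⟩
  (a ⊗ inv f) (suc n) ∎
  where
  open ≡-Reasoning
  shifted : map a (applyUpTo suc (suc n)) ≡ map (a ∘ suc) (upTo (suc n))
  shifted = trans (map-applyUpTo suc a (suc n)) (sym (map-upTo (a ∘ suc) (suc n)))

inv-suc : ∀ f n → inv f (suc n) ≡ - ((f ∘ suc) ⊗ inv f) n
inv-suc f n = cong -_ (invRev-sum f (f ∘ suc) n)

inv-local : ∀ {f f′} n → f ≈[ n ] f′ → inv f ≈[ n ] inv f′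
inv-local n f≈ zero _ = refl
inv-local {f} {f′} (suc n) f≈ (suc i) (s≤s i≤n) = begin
  inv f (suc i)                   ≡⟨ inv-suc f i ⟩
  - ((f ∘ suc) ⊗ inv f) i         ≡⟨ cong -_ (⊗-local i (λ j j≤i → f≈ (suc j) (s≤s (≤-trans j≤i i≤n)))
                                                      (≈-weaken i≤n (inv-local n (≈-weaken (n≤1+n n) f≈)))) ⟩
  - ((f′ ∘ suc) ⊗ inv f′) i       ≡⟨ sym (inv-suc f′ i) ⟩
  inv f′ (suc i)                  ∎
  where open ≡-Reasoning

inv-unique : ∀ f g → f 0 ≡ + 1 → (∀ n → (f ⊗ g) n ≡ 𝟙 n) → g ≗ inv f
inv-unique f g f₀≡1 fg≡1 n = agree n n ≤-refl
  where
  open ≡-Reasoning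
  agree : ∀ m → g ≈[ m ] inv f
  agree m zero _ = begin
    g 0               ≡⟨ sym (*-identityˡ (g 0)) ⟩
    + 1 * g 0         ≡⟨ cong (_* g 0) (sym f₀≡1) ⟩
    f 0 * g 0         ≡⟨ sym (⊗-zero f g) ⟩
    (f ⊗ g) 0         ≡⟨ fg≡1 0 ⟩
    + 1               ∎
  agree (suc m) (suc i) (s≤s i≤m) = begin
    g (suc i)                    ≡⟨ solve-for-first (g (suc i)) _ first-step ⟩
    - ((f ∘ suc) ⊗ g) i          ≡⟨ cong -_ (⊗-local {f = f ∘ suc} i (λ _ _ → refl) (≈-weaken i≤m (agree m))) ⟩
    - ((f ∘ suc) ⊗ inv f) i      ≡⟨ sym (inv-suc f i) ⟩
    inv f (suc i)                ∎
    where
    first-step : + 1 * g (suc i) + ((f ∘ suc) ⊗ g) i ≡ + 0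
    first-step = trans (cong (λ a → a * g (suc i) + ((f ∘ suc) ⊗ g) i) (sym f₀≡1))
                       (trans (sym (⊗-suc f g i)) (fg≡1 (suc i)))
    solve-for-first : ∀ a b → + 1 * a + b ≡ + 0 → a ≡ - b
    solve-for-first a b e = trans (rearrange a b) (trans (cong (_+ - b) e) (+-identityˡ (- b)))
      where
      rearrange : ∀ a b → a ≡ (+ 1 * a + b) + - b
      rearrange = solve-∀

record _≐x²·_ (Q R : Series) : Set where
  field
    coeff₀ : Q 0 ≡ + 0
    coeff₁ : Q 1 ≡ + 0
    coeff₊ : ∀ i → Q (suc (suc i)) ≡ R i
open _≐x²·_

≐-⊖ : ∀ {Q R Q′ R′} → Q ≐x²· R → Q′ ≐x²· R′ → (Q ⊖ Q′) ≐x²· (R ⊖ R′)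
≐-⊖ Q≐ Q′≐ = record
  { coeff₀ = cong₂ _-_ (coeff₀ Q≐) (coeff₀ Q′≐)
  ; coeff₁ = cong₂ _-_ (coeff₁ Q≐) (coeff₁ Q′≐)
  ; coeff₊ = λ i → cong₂ _-_ (coeff₊ Q≐ i) (coeff₊ Q′≐ i) }

≐-⊗ : ∀ {Q R} → Q ≐x²· R → ∀ g → (Q ⊗ g) ≐x²· (R ⊗ g)
≐-⊗ {Q} {R} Q≐ g = record
  { coeff₀ = trans (⊗-zero Q g) (cong (_* g 0) (coeff₀ Q≐))
  ; coeff₁ = trans (⊗-shift Q g 0 (coeff₀ Q≐)) (trans (⊗-zero (Q ∘ suc) g) (cong (_* g 0) (coeff₁ Q≐)))
  ; coeff₊ = λ i → begin
      (Q ⊗ g) (suc (suc i))          ≡⟨ ⊗-shift Q g (suc i) (coeff₀ Q≐) ⟩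
      ((Q ∘ suc) ⊗ g) (suc i)        ≡⟨ ⊗-shift (Q ∘ suc) g i (coeff₁ Q≐) ⟩
      ((Q ∘ suc ∘ suc) ⊗ g) i        ≡⟨ ⊗-congˡ g i (coeff₊ Q≐) ⟩
      (R ⊗ g) i                      ∎ }
  where open ≡-Reasoning

x²≐ : (𝕩 ⊗ 𝕩) ≐x²· 𝟙
x²≐ = record { coeff₀ = refl ; coeff₁ = refl ; coeff₊ = λ i → trans (𝕩⊗ 𝕩 (suc i)) (𝕩-suc i) }

-- If E = 1 + xE + QE with Q = x²T, then (1 - x - Q) E = 1.  The hypothesis is
-- given coefficientwise: E₀ = E₁ = 1 and E_{m+2} = (T E)_m + E_{m+1}.
inverse-from-recurrence : ∀ E T Q → Q ≐x²· T →
  E 0 ≡ + 1 → E 1 ≡ + 1 → (∀ m → E (suc (suc m)) ≡ (T ⊗ E) m + E (suc m)) →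
  ∀ n → ((𝟙 ⊖ 𝕩 ⊖ Q) ⊗ E) n ≡ 𝟙 n
inverse-from-recurrence E T Q Q≐ E₀ E₁ E₊ n = trans expand (coefficient n)
  where
  open ≡-Reasoning
  QE≐ : (Q ⊗ E) ≐x²· (T ⊗ E)
  QE≐ = ≐-⊗ Q≐ E

  expand : ((𝟙 ⊖ 𝕩 ⊖ Q) ⊗ E) n ≡ E n - (𝕩 ⊗ E) n - (Q ⊗ E) n
  expand = begin
    ((𝟙 ⊖ 𝕩 ⊖ Q) ⊗ E) n                ≡⟨ ⊗-⊖ (𝟙 ⊖ 𝕩) Q E n ⟩
    ((𝟙 ⊖ 𝕩) ⊗ E) n - (Q ⊗ E) n        ≡⟨ cong (_- (Q ⊗ E) n) (⊗-⊖ 𝟙 𝕩 E n) ⟩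
    (𝟙 ⊗ E) n - (𝕩 ⊗ E) n - (Q ⊗ E) n  ≡⟨ cong (λ a → a - (𝕩 ⊗ E) n - (Q ⊗ E) n) (𝟙⊗ E n) ⟩
    E n - (𝕩 ⊗ E) n - (Q ⊗ E) n        ∎

  coefficient : ∀ n → E n - (𝕩 ⊗ E) n - (Q ⊗ E) n ≡ 𝟙 n
  coefficient zero = cong₂ (λ a b → a - + 0 - b) E₀ (coeff₀ QE≐)
  coefficient (suc zero) =
    trans (cong₂ (λ a b → a - b - (Q ⊗ E) 1) E₁ (trans (𝕩⊗ E 0) E₀))
          (cong (λ c → + 1 - + 1 - c) (coeff₁ QE≐))
  coefficient (suc (suc m)) = begin
    E (suc (suc m)) - (𝕩 ⊗ E) (suc (suc m)) - (Q ⊗ E) (suc (suc m))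
      ≡⟨ cong₂ (λ a b → a - b - (Q ⊗ E) (suc (suc m))) (E₊ m) (𝕩⊗ E (suc m)) ⟩
    (T ⊗ E) m + E (suc m) - E (suc m) - (Q ⊗ E) (suc (suc m))
      ≡⟨ cong (λ a → (T ⊗ E) m + E (suc m) - E (suc m) - a) (coeff₊ QE≐ m) ⟩
    (T ⊗ E) m + E (suc m) - E (suc m) - (T ⊗ E) m
      ≡⟨ cancel ((T ⊗ E) m) (E (suc m)) ⟩
    + 0 ∎
    where
    cancel : ∀ t e → t + e - e - t ≡ + 0
    cancel = solve-∀

C[_] : Bool → Series
C[ c ] = if c then 𝟘 else 𝕩 ⊗ 𝕩

notIn : Bool → Series
notIn c = if c then 𝟘 else 𝟙

xNotIn : Bool → Series
xNotIn c = if c then 𝟘 else 𝕩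

C≐ : ∀ c → C[ c ] ≐x²· notIn c
C≐ true = record { coeff₀ = refl ; coeff₁ = refl ; coeff₊ = λ _ → refl }
C≐ false = x²≐

xC≐ : ∀ c → (𝕩 ⊗ C[ c ]) ≐x²· xNotIn c
xC≐ true = record { coeff₀ = refl ; coeff₁ = refl ; coeff₊ = λ i → 𝕩⊗ 𝟘 (suc i) }
xC≐ false = record { coeff₀ = refl ; coeff₁ = refl ; coeff₊ = λ i → trans (𝕩⊗ (𝕩 ⊗ 𝕩) (suc i)) (𝕩⊗ 𝕩 i) }

stage : Bool → Series → Series
stage c g = 𝟙 ⊖ 𝕩 ⊕ C[ c ] ⊖ (𝕩 ⊗ 𝕩 ⊖ 𝕩 ⊗ C[ c ]) ⊗ g

stage₀ : ∀ c g → stage c g 0 ≡ + 1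
stage₀ true g = refl
stage₀ false g = refl

-- A stage is determined up to degree m + 1 by g up to degree m, because its
-- numerator x² - xC has no constant term.
stage-local : ∀ c {g g′} m → g ≈[ m ] g′ → stage c g ≈[ suc m ] stage c g′
stage-local c m g≈ zero _ = refl
stage-local c {g} {g′} m g≈ (suc i) (s≤s i≤m) =
  cong (_-_ ((𝟙 ⊖ 𝕩 ⊕ C[ c ]) (suc i))) (begin
    (P ⊗ g) (suc i)         ≡⟨ ⊗-shift P g i refl ⟩
    ((P ∘ suc) ⊗ g) i       ≡⟨ ⊗-local {f = P ∘ suc} i (λ _ _ → refl) (≈-weaken i≤m g≈) ⟩
    ((P ∘ suc) ⊗ g′) i      ≡⟨ sym (⊗-shift P g′ i refl) ⟩
    (P ⊗ g′) (suc i)        ∎)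
  where
  open ≡-Reasoning
  P : Series
  P = 𝕩 ⊗ 𝕩 ⊖ 𝕩 ⊗ C[ c ]

-- The functional equation behind one level of the continued fraction:
-- if E₀ = E₁ = 1 and E_{m+2} = (T E)_m + E_{m+1} with T = (1 - x·notIn c) g - notIn c,
-- then stage c g · E = 1.  Indeed stage c g = 1 - x - x²T.
stage-inverse : ∀ c g E → E 0 ≡ + 1 → E 1 ≡ + 1 →
  (∀ m → E (suc (suc m)) ≡ (((𝟙 ⊖ xNotIn c) ⊗ g ⊖ notIn c) ⊗ E) m + E (suc m)) →
  ∀ n → (stage c g ⊗ E) n ≡ 𝟙 n
stage-inverse c g E E₀ E₁ E₊ n =
  trans (⊗-congˡ E n as-1-x-Q)
        (inverse-from-recurrence E ((𝟙 ⊖ xNotIn c) ⊗ g ⊖ notIn c) Q Q≐ E₀ E₁ E₊ n)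
  where
  P : Series
  P = 𝕩 ⊗ 𝕩 ⊖ 𝕩 ⊗ C[ c ]
  Q : Series
  Q = P ⊗ g ⊖ C[ c ]

  Q≐ : Q ≐x²· ((𝟙 ⊖ xNotIn c) ⊗ g ⊖ notIn c)
  Q≐ = ≐-⊖ (≐-⊗ (≐-⊖ x²≐ (xC≐ c)) g) (C≐ c)

  as-1-x-Q : stage c g ≗ 𝟙 ⊖ 𝕩 ⊖ Q
  as-1-x-Q i = regroup (𝟙 i) (𝕩 i) (C[ c ] i) ((P ⊗ g) i)
    where
    regroup : ∀ a b c d → a - b + c - d ≡ a - b - (d - c)
    regroup = solve-∀

weight : Bool → ℤ
weight true = + 1
weight false = + 0

-- mayEnd b a : may the walk leave its current height without a U step, given
-- that it is in the middle of an ascent (b) and whether that height is allowed (a)?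
mayEnd : Bool → Bool → Bool
mayEnd false _ = true
mayEnd true a = a

-- walks B d b n : the number of walks of length n from height d down to height 0
-- that never go below 0 and whose ascents all end at heights in B; the flag b
-- says that the walk continues an ascent (the step before it was U).
walks : (ℕ → Bool) → ℕ → Bool → ℕ → ℤ
walks B zero b zero = weight (mayEnd b (B 0))
walks B (suc d) b zero = + 0
walks B zero b (suc n) = walks B 1 true n + weight (mayEnd b (B 0)) * walks B 0 false n
walks B (suc d) b (suc n) =
  walks B (suc (suc d)) true n + weight (mayEnd b (B (suc d))) * (walks B (suc d) false n + walks B d false n)

-- First-passage decomposition: a walk from height d+1 reaches height 0 for the
-- first time by a D step from height 1; before it, it is a walk from d to 0
-- shifted up by one (so it sees the heights B ∘ suc), after it a walk from 0 to 0.
walks-split : ∀ B d b n → walks B (suc d) b (suc n) ≡ (walks (B ∘ suc) d b ⊗ walks B 0 false) n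
walks-split B zero b zero = trans (step (weight (mayEnd b (B 1)))) (sym (⊗-zero (walks (B ∘ suc) 0 b) (walks B 0 false)))
  where
  step : ∀ w → + 0 + w * (+ 0 + + 1) ≡ w * + 1
  step = solve-∀
walks-split B (suc d) b zero =
  trans (step (weight (mayEnd b (B (suc (suc d)))))) (sym (⊗-zero (walks (B ∘ suc) (suc d) b) (walks B 0 false)))
  where
  step : ∀ w → + 0 + w * (+ 0 + + 0) ≡ + 0
  step = solve-∀
walks-split B zero b (suc n) = begin
  walks B 2 true (suc n) + w * (walks B 1 false (suc n) + E (suc n))
    ≡⟨ cong₂ (λ x y → x + w * (y + E (suc n))) (walks-split B 1 true n) (walks-split B 0 false n) ⟩
  (walks B′ 1 true ⊗ E) n + w * ((walks B′ 0 false ⊗ E) n + E (suc n))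
    ≡⟨ regroup ((walks B′ 1 true ⊗ E) n) ((walks B′ 0 false ⊗ E) n) w (E (suc n)) ⟩
  w * E (suc n) + ((walks B′ 1 true ⊗ E) n + w * (walks B′ 0 false ⊗ E) n)
    ≡⟨ cong (_+_ (w * E (suc n))) (sym (⊗-affine (walks B′ 1 true) w (walks B′ 0 false) E n)) ⟩
  w * E (suc n) + ((walks B′ 0 b ∘ suc) ⊗ E) n
    ≡⟨ sym (⊗-suc (walks B′ 0 b) E n) ⟩
  (walks B′ 0 b ⊗ E) (suc n) ∎
  where
  open ≡-Reasoning
  B′ : ℕ → Bool
  B′ = B ∘ suc
  E : Series
  E = walks B 0 false
  w : ℤ
  w = weight (mayEnd b (B 1))
  regroup : ∀ x y w e → x + w * (y + e) ≡ w * e + (x + w * y)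
  regroup = solve-∀
walks-split B (suc d) b (suc n) = begin
  walks B (suc (suc (suc d))) true (suc n) + w * (walks B (suc (suc d)) false (suc n) + walks B (suc d) false (suc n))
    ≡⟨ cong₂ (λ x y → x + w * y) (walks-split B (suc (suc d)) true n)
              (cong₂ _+_ (walks-split B (suc d) false n) (walks-split B d false n)) ⟩
  (walks B′ (suc (suc d)) true ⊗ E) n + w * ((walks B′ (suc d) false ⊗ E) n + (walks B′ d false ⊗ E) n)
    ≡⟨ cong (λ y → (walks B′ (suc (suc d)) true ⊗ E) n + w * y)
            (sym (⊗-⊕ (walks B′ (suc d) false) (walks B′ d false) E n)) ⟩
  (walks B′ (suc (suc d)) true ⊗ E) n + w * ((walks B′ (suc d) false ⊕ walks B′ d false) ⊗ E) n
    ≡⟨ sym (⊗-affine (walks B′ (suc (suc d)) true) w (walks B′ (suc d) false ⊕ walks B′ d false) E n) ⟩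
  ((walks B′ (suc d) b ∘ suc) ⊗ E) n
    ≡⟨ sym (trans (⊗-suc (walks B′ (suc d) b) E n) (+-identityˡ (((walks B′ (suc d) b ∘ suc) ⊗ E) n))) ⟩
  (walks B′ (suc d) b ⊗ E) (suc n) ∎
  where
  open ≡-Reasoning
  B′ : ℕ → Bool
  B′ = B ∘ suc
  E : Series
  E = walks B 0 false
  w : ℤ
  w = weight (mayEnd b (B (suc (suc d))))

-- Decomposing by the first step: E = 1 + xE + x² T E, where E counts walks from 0
-- to 0 and T counts those that start in the middle of an ascent at height 1.
walks-recurrence : ∀ B m → walks B 0 false (suc (suc m))
  ≡ (walks (B ∘ suc) 0 true ⊗ walks B 0 false) m + walks B 0 false (suc m)
walks-recurrence B m = cong₂ _+_ (walks-split B 0 true m) (*-identityˡ (walks B 0 false (suc m)))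

-- An ascent in progress at an allowed height 0 imposes no constraint ...
ascent-allowed : ∀ B → B 0 ≡ true → walks B 0 true ≗ walks B 0 false
ascent-allowed B B₀ zero rewrite B₀ = refl
ascent-allowed B B₀ (suc n) rewrite B₀ = refl

-- ... while at a forbidden height 0 it must go on with another U step, which
-- removes the empty walk and the walks beginning with F:  T = (1 - x) E - 1.
ascent-forbidden : ∀ B → B 0 ≡ false → ∀ n →
  walks B 0 true n ≡ ((𝟙 ⊖ 𝕩) ⊗ walks B 0 false) n - 𝟙 n
ascent-forbidden B B₀ n = trans (coefficient n) (sym (expand n))
  where
  E : Series
  E = walks B 0 false
  expand : ∀ n → ((𝟙 ⊖ 𝕩) ⊗ E) n - 𝟙 n ≡ E n - (𝕩 ⊗ E) n - 𝟙 n
  expand n = cong (_- 𝟙 n) (trans (⊗-⊖ 𝟙 𝕩 E n) (cong (_- (𝕩 ⊗ E) n) (𝟙⊗ E n)))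
  coefficient : ∀ n → walks B 0 true n ≡ E n - (𝕩 ⊗ E) n - 𝟙 n
  coefficient zero rewrite B₀ = refl
  coefficient (suc m) rewrite B₀ | 𝕩⊗ E m = cancel (walks B 1 true m) (E m)
    where
    cancel : ∀ t e → t + + 0 * e ≡ t + + 1 * e - e - + 0
    cancel = solve-∀

ascent-series : ∀ B c → B 0 ≡ c → walks B 0 true ≗ (𝟙 ⊖ xNotIn c) ⊗ walks B 0 false ⊖ notIn c
ascent-series B true B₀ n = begin
  walks B 0 true n                   ≡⟨ ascent-allowed B B₀ n ⟩
  walks B 0 false n                  ≡⟨ sym (𝟙⊗ (walks B 0 false) n) ⟩
  (𝟙 ⊗ walks B 0 false) n            ≡⟨ ⊗-congˡ (walks B 0 false) n (λ i → sym (+-identityʳ (𝟙 i))) ⟩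
  ((𝟙 ⊖ 𝟘) ⊗ walks B 0 false) n      ≡⟨ sym (+-identityʳ _) ⟩
  ((𝟙 ⊖ 𝟘) ⊗ walks B 0 false) n - + 0 ∎
  where open ≡-Reasoning
ascent-series B false B₀ = ascent-forbidden B B₀

walks-inverse : ∀ B c → B 1 ≡ c → ∀ n → (stage c (walks (B ∘ suc) 0 false) ⊗ walks B 0 false) n ≡ 𝟙 n
walks-inverse B c B₁ = stage-inverse c (walks (B ∘ suc) 0 false) (walks B 0 false) refl refl recurrence
  where
  recurrence : ∀ m → walks B 0 false (suc (suc m)) ≡
    (((𝟙 ⊖ xNotIn c) ⊗ walks (B ∘ suc) 0 false ⊖ notIn c) ⊗ walks B 0 false) m + walks B 0 false (suc m)
  recurrence m = trans (walks-recurrence B m)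
    (cong (_+ walks B 0 false (suc m)) (⊗-congˡ (walks B 0 false) m (ascent-series (B ∘ suc) c B₁)))

-- ascFrom A h b s : every ascent of s, started at height h, ends at a height in A;
-- if b holds, s continues an ascent that is already in progress.
ascFrom : (ℕ → Bool) → ℕ → Bool → List Step → Bool
ascFrom A h false s = ascOK A h s
ascFrom A h true [] = A h
ascFrom A h true (U ∷ s) = ascFrom A (suc h) true s
ascFrom A h true (F ∷ s) = A h ∧ ascOK A h s
ascFrom A h true (D ∷ s) = A h ∧ ascOK A (h ∸ 1) s

valid : (ℕ → Bool) → ℕ → Bool → List Step → Bool
valid A h b s = motzkinFrom h s ∧ ascFrom A h b s

∧-swap : ∀ a b c → a ∧ (b ∧ c) ≡ b ∧ (a ∧ c)
∧-swap a true c = refl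
∧-swap a false c = ∧-zeroʳ a

valid-U : ∀ A h b s → valid A h b (U ∷ s) ≡ valid A (suc h) true s
valid-U A h true s = refl
valid-U A h false s = cong (motzkinFrom (suc h) s ∧_) (ascOK-U s)
  where
  ascOK-U : ∀ {h} s → ascOK A h (U ∷ s) ≡ ascFrom A (suc h) true s
  ascOK-U [] = refl
  ascOK-U (U ∷ s) = ascOK-U s
  ascOK-U (F ∷ s) = refl
  ascOK-U (D ∷ s) = refl

valid-F : ∀ A h b s → valid A h b (F ∷ s) ≡ mayEnd b (A h) ∧ valid A h false s
valid-F A h false s = refl
valid-F A h true s = ∧-swap (motzkinFrom h s) (A h) (ascOK A h s)

valid-D : ∀ A h b s → valid A (suc h) b (D ∷ s) ≡ mayEnd b (A (suc h)) ∧ valid A h false s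
valid-D A h false s = refl
valid-D A h true s = ∧-swap (motzkinFrom h s) (A (suc h)) (ascOK A h s)

count-++ : ∀ {X : Set} (P : X → Bool) xs ys → count P (xs ++ ys) ≡ count P xs +ℕ count P ys
count-++ P [] ys = refl
count-++ P (x ∷ xs) ys with P x
... | true = cong suc (count-++ P xs ys)
... | false = count-++ P xs ys

count-map : ∀ {X Y : Set} (P : Y → Bool) (f : X → Y) xs → count P (map f xs) ≡ count (λ x → P (f x)) xs
count-map P f [] = refl
count-map P f (x ∷ xs) with P (f x)
... | true = cong suc (count-map P f xs)
... | false = count-map P f xs

count-cong : ∀ {X : Set} {P Q : X → Bool} xs → (∀ x → P x ≡ Q x) → count P xs ≡ count Q xs
count-cong [] P≗Q = refl
count-cong {Q = Q} (x ∷ xs) P≗Q rewrite P≗Q x with Q x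
... | true = cong suc (count-cong xs P≗Q)
... | false = count-cong xs P≗Q

count-false : ∀ {X : Set} (xs : List X) → count (λ _ → false) xs ≡ 0
count-false [] = refl
count-false (x ∷ xs) = count-false xs

count-single : ∀ {X : Set} (P : X → Bool) x → + count P (x ∷ []) ≡ weight (P x)
count-single P x with P x
... | true = refl
... | false = refl

count-weighted : ∀ {X : Set} {P Q : X → Bool} c xs → (∀ x → P x ≡ c ∧ Q x) →
  + count P xs ≡ weight c * + count Q xs
count-weighted true xs P≗ = trans (cong +_ (count-cong xs P≗)) (sym (*-identityˡ _))
count-weighted false xs P≗ = cong +_ (trans (count-cong xs P≗) (count-false xs))

count-allWords : ∀ (P : List Step → Bool) n → + count P (allWords (suc n))
  ≡ + count (λ s → P (U ∷ s)) (allWords n)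
    + (+ count (λ s → P (F ∷ s)) (allWords n) + + count (λ s → P (D ∷ s)) (allWords n))
count-allWords P n = trans (cong +_ split)
  (trans (pos-+ (count (λ s → P (U ∷ s)) ws) _)
         (cong (_+_ (+ count (λ s → P (U ∷ s)) ws)) (pos-+ (count (λ s → P (F ∷ s)) ws) _)))
  where
  ws : List (List Step)
  ws = allWords n
  split : count P (map (U ∷_) ws ++ (map (F ∷_) ws ++ (map (D ∷_) ws ++ [])))
        ≡ count (λ s → P (U ∷ s)) ws +ℕ (count (λ s → P (F ∷ s)) ws +ℕ count (λ s → P (D ∷ s)) ws)
  split rewrite count-++ P (map (U ∷_) ws) (map (F ∷_) ws ++ (map (D ∷_) ws ++ []))
              | count-++ P (map (F ∷_) ws) (map (D ∷_) ws ++ [])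
              | count-++ P (map (D ∷_) ws) []
              | count-map P (U ∷_) ws | count-map P (F ∷_) ws | count-map P (D ∷_) ws
              | +ℕ-identityʳ (count (λ s → P (D ∷ s)) ws) = refl

walks-count : ∀ A h b n → + count (valid A h b) (allWords n) ≡ walks A h b n
count-U : ∀ A h b n → + count (λ s → valid A h b (U ∷ s)) (allWords n) ≡ walks A (suc h) true n
count-F : ∀ A h b n → + count (λ s → valid A h b (F ∷ s)) (allWords n) ≡ weight (mayEnd b (A h)) * walks A h false n
count-D : ∀ A h b n → + count (λ s → valid A (suc h) b (D ∷ s)) (allWords n) ≡ weight (mayEnd b (A (suc h))) * walks A h false n

count-U A h b n = trans (cong +_ (count-cong (allWords n) (valid-U A h b))) (walks-count A (suc h) true n)
count-F A h b n = trans (count-weighted {Q = valid A h false} (mayEnd b (A h)) (allWords n) (valid-F A h b))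
                        (cong (weight (mayEnd b (A h)) *_) (walks-count A h false n))
count-D A h b n = trans (count-weighted {Q = valid A h false} (mayEnd b (A (suc h))) (allWords n) (valid-D A h b))
                        (cong (weight (mayEnd b (A (suc h))) *_) (walks-count A h false n))

walks-count A zero false zero = refl
walks-count A zero true zero = count-single (valid A 0 true) []
walks-count A (suc h) b zero = refl
walks-count A zero b (suc n) = begin
  + count (valid A 0 b) (allWords (suc n))
    ≡⟨ count-allWords (valid A 0 b) n ⟩
  + count (λ s → valid A 0 b (U ∷ s)) ws + (+ count (λ s → valid A 0 b (F ∷ s)) ws + + count (λ s → valid A 0 b (D ∷ s)) ws)
    ≡⟨ cong₂ (λ u f → u + (f + + count (λ s → valid A 0 b (D ∷ s)) ws)) (count-U A 0 b n) (count-F A 0 b n) ⟩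
  walks A 1 true n + (w * walks A 0 false n + + count (λ s → valid A 0 b (D ∷ s)) ws)
    ≡⟨ cong (λ z → walks A 1 true n + (w * walks A 0 false n + + z)) (count-false ws) ⟩
  walks A 1 true n + (w * walks A 0 false n + + 0)
    ≡⟨ cong (_+_ (walks A 1 true n)) (+-identityʳ (w * walks A 0 false n)) ⟩
  walks A 0 b (suc n) ∎
  where
  open ≡-Reasoning
  ws : List (List Step)
  ws = allWords n
  w : ℤ
  w = weight (mayEnd b (A 0))
walks-count A (suc h) b (suc n) = begin
  + count (valid A (suc h) b) (allWords (suc n))
    ≡⟨ count-allWords (valid A (suc h) b) n ⟩
  + count (λ s → valid A (suc h) b (U ∷ s)) ws
    + (+ count (λ s → valid A (suc h) b (F ∷ s)) ws + + count (λ s → valid A (suc h) b (D ∷ s)) ws)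
    ≡⟨ cong₂ _+_ (count-U A (suc h) b n) (cong₂ _+_ (count-F A (suc h) b n) (count-D A h b n)) ⟩
  walks A (suc (suc h)) true n + (w * walks A (suc h) false n + w * walks A h false n)
    ≡⟨ cong (_+_ (walks A (suc (suc h)) true n)) (sym (*-distribˡ-+ w (walks A (suc h) false n) (walks A h false n))) ⟩
  walks A (suc h) b (suc n) ∎
  where
  open ≡-Reasoning
  ws : List (List Step)
  ws = allWords n
  w : ℤ
  w = weight (mayEnd b (A (suc h)))

lift : (ℕ → Bool) → ℕ → ℕ → Bool
lift A zero = A
lift A (suc j) = lift A j ∘ suc

lift-spec : ∀ A j m → lift A j m ≡ A (m +ℕ j)
lift-spec A zero m = cong A (sym (+ℕ-identityʳ m))
lift-spec A (suc j) m = trans (lift-spec A j (suc m)) (cong A (sym (+-suc m j)))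

-- excursions A j : the series E_j of paths from height j back to height j that
-- stay at least j and whose ascents all end in A.
excursions : (ℕ → Bool) → ℕ → Series
excursions A j = walks (lift A j) 0 false

exactDen : (ℕ → Bool) → ℕ → Series
exactDen A j = stage (A (suc j)) (excursions A (suc j))

excursions-inverse : ∀ A j → excursions A j ≗ inv (exactDen A j)
excursions-inverse A j = inv-unique (exactDen A j) (excursions A j) (stage₀ (A (suc j)) (excursions A (suc j)))
                           (walks-inverse (lift A j) (A (suc j)) (lift-spec A j 1))

-- The k-th truncation agrees with the exact denominator up to degree k, since each
-- extra level fixes one more coefficient (stage-local).
den-agree : ∀ A k j → den A k (suc j) ≈[ k ] exactDen A j
den-agree A zero j zero z≤n = sym (+-identityʳ _)
den-agree A (suc k) j = stage-local (A (suc j)) k tails-agree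
  where
  tails-agree : inv (den A k (suc (suc j))) ≈[ k ] excursions A (suc j)
  tails-agree i i≤k = trans (inv-local k (den-agree A k (suc j)) i i≤k) (sym (excursions-inverse A (suc j) i))

theorem9 : (A : ℕ → Bool) → (n : ℕ) →
    ∃[ K ] ((k : ℕ) → K ≤ k → cfTrunc A k n ≡ + ascCount A n)
theorem9 A n = n , λ k n≤k → begin
  cfTrunc A k n              ≡⟨ inv-local n (≈-weaken n≤k (den-agree A k 0)) n ≤-refl ⟩
  inv (exactDen A 0) n       ≡⟨ sym (excursions-inverse A 0 n) ⟩
  walks A 0 false n          ≡⟨ sym (walks-count A 0 false n) ⟩
  + ascCount A n             ∎
  where open ≡-Reasoning
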